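{- Let $k\ge3$ and let $a_0,a_1$ be two different edges of $T^k_{2k}$ with $m:=|a_0\cap a_1|\ge1$. Then there exist $k-m-1$ distinct edges $e_1,\ldots,e_{k-m-1}\in E(T^k_{2k})\setminus\{a_0,a_1\}$ such that for each $i\in\{1,\ldots,k-m-1\}$: (1) $|e_i\cap a_0\cap a_1|=m$; (2) $|e_i\cap(a_0\setminus a_1)|=i$; (3) $|e_i\cap(a_1\setminus a_0)|=k-m-i$. Moreover, for each edge $e'\in E(T^k_{2k})\setminus\{a_0,a_1,e_1,\ldots,e_{k-m-1}\}$ there exists $b\in\{0,1\}$ such that (i) $|e'\cap a_0\cap a_1|\le m-1$; (ii) $|e'\cap(a_b\setminus a_{1-b})|=0$; (iii) $|e'\cap(a_{1-b}\setminus a_b)|=k-m$.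
   Context: $T^k_{2k}$ is the $k$-uniform tight path with vertices $v_1,\ldots,v_{2k}$ and edges $\{v_i,\ldots,v_{i+k-1}\}$ for $1\le i\le k+1$. -}

module Defs where

open import Data.Nat using (ℕ; suc; _+_; _≤ᵇ_; _<ᵇ_)
open import Data.Bool using (_∧_; if_then_else_)
open import Data.Fin using (Fin; toℕ)
open import Data.Fin.Subset using (Subset; inside; outside)
open import Data.Vec using (tabulate)
open import Data.Product using (∃)
open import Relation.Binary.PropositionalEquality using (_≡_)

-- Vertex set of T^k_{2k}: Fin (k + k), vertex v_j (1 ≤ j ≤ 2k) is the element j-1.
-- Edge with (0-based) start s ∈ {0,…,k}: {v_{s+1},…,v_{s+k}} = {s,…,s+k-1} as a subset.
tightEdge : (k : ℕ) → Fin (suc k) → Subset (k + k)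
tightEdge k s = tabulate λ v →
  if (toℕ s ≤ᵇ toℕ v) ∧ (toℕ v <ᵇ toℕ s + k) then inside else outside

IsEdge : (k : ℕ) → Subset (k + k) → Set
IsEdge k e = ∃ λ (s : Fin (suc k)) → tightEdge k s ≡ e

module Submission where

-- The vertices of T^k_{2k} are 0,…,2k-1 and the edge with start u is the
-- interval [u, u+k).  Take a₀ = [s, s+k) and a₁ = [s+d, s+d+k) with d ≥ 0 (the case where
-- a₁ lies to the left of a₀ follows by exchanging the two edges and reversing the order of
-- the indices i).  Then the three regions a₀∩a₁ = [s+d, s+k), a₀─a₁ = [s, s+d) and
-- a₁─a₀ = [s+k, s+d+k) are intervals, so m = k-d, and an edge [v, v+k) meets an interval
-- [lo, hi) in exactly min(v+k, hi) - max(v, lo) vertices.  Evaluating this formula gives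
-- the "profile" of every edge: for s ≤ v ≤ s+d it is (m, s+d-v, v-s); for v < s it is
-- (< m, d, 0); for v > s+d it is (< m, 0, d).  The edges e_i are the ones starting at
-- v = s+d-1-i (0 ≤ i < d-1), and every other edge starts left of s or right of s+d.

open import Defs
open import Data.Nat using (ℕ; zero; suc; _+_; _∸_; _≤_; _<_; _⊔_; _⊓_; z≤n; s≤s)
open import Data.Nat.Properties
open import Data.Fin using (Fin; toℕ; fromℕ<; opposite) renaming (zero to fzero; suc to fsuc)
open import Data.Fin.Properties using (toℕ≤pred[n]; toℕ<n; toℕ-injective; toℕ-fromℕ<; opposite-prop; opposite-involutive)
open import Data.Fin.Subset using (Subset; _∈_; _∉_; _∩_; _─_; ∣_∣; inside; outside)
open import Data.Fin.Subset.Properties using (x∈p∩q⁺; x∈p∩q⁻; drop-there; drop-not-there; ∩-comm)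
open import Data.Vec using ([]; _∷_; here; there)
open import Data.Vec.Properties using (lookup∘tabulate; []=⇒lookup; lookup⇒[]=)
open import Data.Bool using (Bool; true; false; T; if_then_else_)
open import Data.Bool.Properties using (T-∧)
open import Data.Product using (Σ; _×_; _,_; proj₁; proj₂)
open import Data.Product.Function.NonDependent.Propositional using (_×-⇔_)
open import Data.Sum using (_⊎_; inj₁; inj₂) renaming (swap to ⊎-swap)
open import Data.Empty using (⊥-elim)
open import Function using (_∘_)
open import Function.Bundles using (_⇔_; mk⇔; Equivalence)
open import Function.Properties.Equivalence using () renaming (trans to ⇔-trans)
open import Function.Related.TypeIsomorphisms using (¬-cong-⇔)
open import Relation.Nullary using (¬_)
open import Relation.Binary using (tri<; tri≈; tri>)
open import Relation.Binary.PropositionalEquality using (_≡_; _≢_; refl; sym; trans; cong; cong₂; subst; module ≡-Reasoning)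

open Equivalence using (to; from)

InRange : ℕ → ℕ → ℕ → Set
InRange lo hi j = lo ≤ j × j < hi

IsInterval : {n : ℕ} → Subset n → ℕ → ℕ → Set
IsInterval p lo hi = ∀ x → x ∈ p ⇔ InRange lo hi (toℕ x)

interval-cong : {n : ℕ} {p : Subset n} {lo lo′ hi hi′ : ℕ} →
  lo ≡ lo′ → hi ≡ hi′ → IsInterval p lo hi → IsInterval p lo′ hi′
interval-cong refl refl p-int = p-int

range-pred : (lo hi j : ℕ) → InRange lo hi (suc j) ⇔ InRange (lo ∸ 1) (hi ∸ 1) j
range-pred zero     zero     j = mk⇔ (λ ()) (λ ())
range-pred zero     (suc hi) j = mk⇔ (λ { (_ , s≤s j<hi) → z≤n , j<hi })
                                     (λ { (_ , j<hi) → z≤n , s≤s j<hi })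
range-pred (suc lo) zero     j = mk⇔ (λ ()) (λ ())
range-pred (suc lo) (suc hi) j = mk⇔ (λ { (s≤s lo≤j , s≤s j<hi) → lo≤j , j<hi })
                                     (λ { (lo≤j , j<hi) → s≤s lo≤j , s≤s j<hi })

tail-interval : {n : ℕ} {b : Bool} {p : Subset n} {lo hi : ℕ} →
  IsInterval (b ∷ p) lo hi → IsInterval p (lo ∸ 1) (hi ∸ 1)
tail-interval {lo = lo} {hi} bp-int x =
  ⇔-trans (mk⇔ there drop-there) (⇔-trans (bp-int (fsuc x)) (range-pred lo hi (toℕ x)))

interval-size : {n : ℕ} (p : Subset n) (lo hi : ℕ) → hi ≤ n → IsInterval p lo hi → ∣ p ∣ ≡ hi ∸ lo
interval-size []             lo       zero     z≤n        _     = sym (0∸n≡0 lo)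
interval-size (inside ∷ p)   zero     zero     _          p-int = ⊥-elim (n≮0 (proj₂ (to (p-int fzero) here)))
interval-size (inside ∷ p)   zero     (suc hi) (s≤s hi≤n) p-int =
  cong suc (interval-size p 0 hi hi≤n (tail-interval p-int))
interval-size (inside ∷ p)   (suc lo) hi       _          p-int = ⊥-elim (n≮0 (proj₁ (to (p-int fzero) here)))
interval-size (outside ∷ p)  zero     (suc hi) _          p-int with from (p-int fzero) (z≤n , s≤s z≤n)
... | ()
interval-size (outside ∷ p)  lo       zero     _          p-int = begin
  ∣ p ∣        ≡⟨ interval-size p (lo ∸ 1) 0 z≤n (tail-interval p-int) ⟩
  0 ∸ (lo ∸ 1) ≡⟨ 0∸n≡0 (lo ∸ 1) ⟩
  0            ≡⟨ sym (0∸n≡0 lo) ⟩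
  0 ∸ lo       ∎
  where open ≡-Reasoning
interval-size (outside ∷ p)  (suc lo) (suc hi) (s≤s hi≤n) p-int =
  interval-size p lo hi hi≤n (tail-interval p-int)

range-∩ : (a b c d j : ℕ) → (InRange a b j × InRange c d j) ⇔ InRange (a ⊔ c) (b ⊓ d) j
range-∩ a b c d j = mk⇔
  (λ { ((a≤j , j<b) , (c≤j , j<d)) → ⊔-lub a≤j c≤j , ⊓-glb j<b j<d })
  (λ { (a⊔c≤j , j<b⊓d) → (m⊔n≤o⇒m≤o a c a⊔c≤j , m≤n⊓o⇒m≤n b d j<b⊓d)
                        , (m⊔n≤o⇒n≤o a c a⊔c≤j , m≤n⊓o⇒m≤o b d j<b⊓d) })

range-─-upper : (a b c d j : ℕ) → b ≤ d → (InRange a b j × ¬ InRange c d j) ⇔ InRange a (b ⊓ c) j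
range-─-upper a b c d j b≤d = mk⇔
  (λ { ((a≤j , j<b) , j∉cd) → a≤j , ⊓-glb j<b (≰⇒> (λ c≤j → j∉cd (c≤j , <-≤-trans j<b b≤d))) })
  (λ { (a≤j , j<b⊓c) → (a≤j , m≤n⊓o⇒m≤n b c j<b⊓c)
                      , (λ { (c≤j , _) → <⇒≱ (m≤n⊓o⇒m≤o b c j<b⊓c) c≤j }) })

range-─-lower : (a b c d j : ℕ) → c ≤ a → (InRange a b j × ¬ InRange c d j) ⇔ InRange (a ⊔ d) b j
range-─-lower a b c d j c≤a = mk⇔
  (λ { ((a≤j , j<b) , j∉cd) → ⊔-lub a≤j (≮⇒≥ (λ j<d → j∉cd (≤-trans c≤a a≤j , j<d))) , j<b })
  (λ { (a⊔d≤j , j<b) → (m⊔n≤o⇒m≤o a d a⊔d≤j , j<b)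
                      , (λ { (_ , j<d) → <⇒≱ j<d (m⊔n≤o⇒n≤o a d a⊔d≤j) }) })

∈─ : {n : ℕ} (p q : Subset n) (x : Fin n) → x ∈ p ─ q ⇔ (x ∈ p × x ∉ q)
∈─ (b       ∷ p) (inside  ∷ q) fzero    = mk⇔ (λ ()) (λ (_ , x∉q) → ⊥-elim (x∉q here))
∈─ (inside  ∷ p) (outside ∷ q) fzero    = mk⇔ (λ _ → here , λ ()) (λ _ → here)
∈─ (outside ∷ p) (outside ∷ q) fzero    = mk⇔ (λ ()) (λ { (() , _) })
∈─ (b       ∷ p) (c       ∷ q) (fsuc x) = mk⇔
  (λ x∈ → let (x∈p , x∉q) = to (∈─ p q x) (drop-there x∈)
          in there x∈p , λ sx∈ → x∉q (drop-there sx∈))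
  (λ (sx∈p , sx∉q) → there (from (∈─ p q x) (drop-there sx∈p , drop-not-there sx∉q)))

interval-∩ : {n : ℕ} {p q : Subset n} {a b c d : ℕ} →
  IsInterval p a b → IsInterval q c d → IsInterval (p ∩ q) (a ⊔ c) (b ⊓ d)
interval-∩ {p = p} {q} {a} {b} {c} {d} p-int q-int x =
  ⇔-trans (mk⇔ (x∈p∩q⁻ p q) x∈p∩q⁺) (⇔-trans (p-int x ×-⇔ q-int x) (range-∩ a b c d (toℕ x)))

interval-─-upper : {n : ℕ} {p q : Subset n} {a b c d : ℕ} → b ≤ d →
  IsInterval p a b → IsInterval q c d → IsInterval (p ─ q) a (b ⊓ c)
interval-─-upper {p = p} {q} {a} {b} {c} {d} b≤d p-int q-int x =
  ⇔-trans (∈─ p q x) (⇔-trans (p-int x ×-⇔ ¬-cong-⇔ (q-int x)) (range-─-upper a b c d (toℕ x) b≤d))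

interval-─-lower : {n : ℕ} {p q : Subset n} {a b c d : ℕ} → c ≤ a →
  IsInterval p a b → IsInterval q c d → IsInterval (p ─ q) (a ⊔ d) b
interval-─-lower {p = p} {q} {a} {b} {c} {d} c≤a p-int q-int x =
  ⇔-trans (∈─ p q x) (⇔-trans (p-int x ×-⇔ ¬-cong-⇔ (q-int x)) (range-─-lower a b c d (toℕ x) c≤a))

edge-interval : (k : ℕ) (u : Fin (suc k)) → IsInterval (tightEdge k u) (toℕ u) (toℕ u + k)
edge-interval k u x =
  ⇔-trans (mk⇔ (λ x∈ → trans (sym (lookup∘tabulate _ x)) ([]=⇒lookup x∈))
               (λ eq → lookup⇒[]= x _ (trans (lookup∘tabulate _ x) eq)))
  (⇔-trans (if-true _) (⇔-trans T-∧
    (mk⇔ (≤ᵇ⇒≤ _ _) ≤⇒≤ᵇ ×-⇔ mk⇔ (<ᵇ⇒< _ _) <⇒<ᵇ)))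
  where
  if-true : (c : Bool) → (if c then inside else outside) ≡ inside ⇔ T c
  if-true true  = mk⇔ _ (λ _ → refl)
  if-true false = mk⇔ (λ ()) (λ ())

start≤k : {k : ℕ} (u : Fin (suc k)) → toℕ u ≤ k
start≤k = toℕ≤pred[n]

-- For k ≥ 1 an edge determines its start: the start is its least vertex.
edge-injective : (k : ℕ) → 1 ≤ k → (U V : Fin (suc k)) → tightEdge k U ≡ tightEdge k V → U ≡ V
edge-injective k k≥1 U V eq = toℕ-injective (≤-antisym (later-start V U (sym eq)) (later-start U V eq))
  where
  later-start : (U V : Fin (suc k)) → tightEdge k U ≡ tightEdge k V → toℕ V ≤ toℕ U
  later-start U V eq = subst (toℕ V ≤_) (toℕ-fromℕ< u<2k)
    (proj₁ (to (edge-interval k V first) (subst (first ∈_) eq first∈U)))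
    where
    u<2k : toℕ U < k + k
    u<2k = ≤-<-trans (start≤k U) (m<m+n k k≥1)
    first : Fin (k + k)
    first = fromℕ< u<2k
    first∈U : first ∈ tightEdge k U
    first∈U = from (edge-interval k U first)
      (subst (InRange (toℕ U) (toℕ U + k)) (sym (toℕ-fromℕ< u<2k)) (≤-refl , m<m+n (toℕ U) k≥1))

edge-meets-interval : (k : ℕ) (v : Fin (suc k)) {p : Subset (k + k)} {lo hi : ℕ} →
  IsInterval p lo hi → ∣ tightEdge k v ∩ p ∣ ≡ ((toℕ v + k) ⊓ hi) ∸ (toℕ v ⊔ lo)
edge-meets-interval k v {hi = hi} p-int = interval-size _ _ _
  (≤-trans (m⊓n≤m _ hi) (+-monoˡ-≤ k (start≤k v))) (interval-∩ (edge-interval k v) p-int)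

-- Properties (1)–(3) of the edge e playing the role of e_{i+1} for the ordered pair a₀, a₁.
-- Here c stands for a₀ ∩ a₁, m for its size and g for k - m, the size of a₀ ─ a₁.
IsIntermediateEdge : (k : ℕ) (a₀ a₁ c : Subset (k + k)) (m g : ℕ) → Fin (g ∸ 1) → Subset (k + k) → Set
IsIntermediateEdge k a₀ a₁ c m g i e =
  IsEdge k e × e ≢ a₀ × e ≢ a₁
  × ∣ e ∩ c ∣ ≡ m
  × ∣ e ∩ (a₀ ─ a₁) ∣ ≡ suc (toℕ i)
  × ∣ e ∩ (a₁ ─ a₀) ∣ ≡ g ∸ suc (toℕ i)

-- Properties (i)–(iii) of an edge e′, the two disjuncts being the choices b = 0 and b = 1.
IsOuterEdge : (k : ℕ) (a₀ a₁ c : Subset (k + k)) (m g : ℕ) → Subset (k + k) → Set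
IsOuterEdge k a₀ a₁ c m g e′ =
  (suc ∣ e′ ∩ c ∣ ≤ m × ∣ e′ ∩ (a₀ ─ a₁) ∣ ≡ 0 × ∣ e′ ∩ (a₁ ─ a₀) ∣ ≡ g)
  ⊎ (suc ∣ e′ ∩ c ∣ ≤ m × ∣ e′ ∩ (a₁ ─ a₀) ∣ ≡ 0 × ∣ e′ ∩ (a₀ ─ a₁) ∣ ≡ g)

Conclusion : (k : ℕ) (a₀ a₁ c : Subset (k + k)) (m g : ℕ) → Set
Conclusion k a₀ a₁ c m g =
  Σ (Fin (g ∸ 1) → Subset (k + k)) λ e →
    ((i j : Fin (g ∸ 1)) → e i ≡ e j → i ≡ j)
    × ((i : Fin (g ∸ 1)) → IsIntermediateEdge k a₀ a₁ c m g i (e i))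
    × ((e′ : Subset (k + k)) → IsEdge k e′ → e′ ≢ a₀ → e′ ≢ a₁ → ((i : Fin (g ∸ 1)) → e′ ≢ e i) →
        IsOuterEdge k a₀ a₁ c m g e′)

complement-left : {a b g : ℕ} → a + b ≡ g → g ∸ a ≡ b
complement-left {a} {b} refl = m+n∸m≡n a b

complement-right : {a b g : ℕ} → a + b ≡ g → g ∸ b ≡ a
complement-right {a} {b} refl = m+n∸n≡m a b

opposite-complement : (g : ℕ) (i : Fin (g ∸ 1)) → suc (toℕ (opposite i)) + suc (toℕ i) ≡ g
opposite-complement (suc g) i = cong suc (begin
  toℕ (opposite i) + suc (toℕ i)  ≡⟨ cong (_+ suc (toℕ i)) (opposite-prop i) ⟩
  g ∸ suc (toℕ i) + suc (toℕ i)   ≡⟨ m∸n+n≡m (toℕ<n i) ⟩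
  g                               ∎)
  where open ≡-Reasoning

opposite-injective : {n : ℕ} (i j : Fin n) → opposite i ≡ opposite j → i ≡ j
opposite-injective i j eq = begin
  i                       ≡⟨ sym (opposite-involutive i) ⟩
  opposite (opposite i)   ≡⟨ cong opposite eq ⟩
  opposite (opposite j)   ≡⟨ opposite-involutive j ⟩
  j                       ∎
  where open ≡-Reasoning

-- The conclusion is symmetric in a₀ and a₁: exchange them and list the e_i in reverse order.
swap-conclusion : {k : ℕ} {a₀ a₁ c : Subset (k + k)} {m g : ℕ} →
  Conclusion k a₁ a₀ c m g → Conclusion k a₀ a₁ c m g
swap-conclusion {k} {a₀} {a₁} {c} {m} {g} (e , e-injective , intermediate , outer) =
  e ∘ opposite , reversed-injective , reversed-intermediate , reversed-outer
  where
  reversed-injective : (i j : Fin (g ∸ 1)) → e (opposite i) ≡ e (opposite j) → i ≡ j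
  reversed-injective i j eq = opposite-injective i j (e-injective _ _ eq)

  reversed-intermediate : (i : Fin (g ∸ 1)) → IsIntermediateEdge k a₀ a₁ c m g i (e (opposite i))
  reversed-intermediate i with intermediate (opposite i)
  ... | edge , ≢a₁ , ≢a₀ , common , only₁ , only₀ =
    edge , ≢a₀ , ≢a₁ , common ,
    trans only₀ (complement-left {a = suc (toℕ (opposite i))} (opposite-complement g i)) ,
    trans only₁ (sym (complement-right {b = suc (toℕ i)} (opposite-complement g i)))

  reversed-outer : (e′ : Subset (k + k)) → IsEdge k e′ → e′ ≢ a₀ → e′ ≢ a₁ →
    ((i : Fin (g ∸ 1)) → e′ ≢ e (opposite i)) → IsOuterEdge k a₀ a₁ c m g e′
  reversed-outer e′ edge ≢a₀ ≢a₁ ≢e = ⊎-swap (outer e′ edge ≢a₁ ≢a₀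
    (λ j eq → ≢e (opposite j) (trans eq (cong e (sym (opposite-involutive j))))))

[m+o]∸[n+o]≡m∸n : (m n o : ℕ) → (m + o) ∸ (n + o) ≡ m ∸ n
[m+o]∸[n+o]≡m∸n m n o = trans (cong₂ _∸_ (+-comm m o) (+-comm n o)) ([m+n]∸[m+o]≡n∸o o m n)

module LeftToRight (k : ℕ) (k≥1 : 1 ≤ k) (S T : Fin (suc k)) (d : ℕ) (T-start : toℕ T ≡ toℕ S + d) where

  s : ℕ
  s = toℕ S

  A B : Subset (k + k)
  A = tightEdge k S
  B = tightEdge k T

  s+d≤k : s + d ≤ k
  s+d≤k = subst (_≤ k) T-start (start≤k T)

  s+d≤s+k : s + d ≤ s + k
  s+d≤s+k = +-monoʳ-≤ s (≤-trans (m≤n+m d s) s+d≤k)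

  s+k≤s+d+k : s + k ≤ s + d + k
  s+k≤s+d+k = +-monoˡ-≤ k (m≤m+n s d)

  B-interval : IsInterval B (s + d) (s + d + k)
  B-interval = interval-cong T-start (cong (_+ k) T-start) (edge-interval k T)

  common-interval : IsInterval (A ∩ B) (s + d) (s + k)
  common-interval = interval-cong (m≤n⇒m⊔n≡n (m≤m+n s d)) (m≤n⇒m⊓n≡m s+k≤s+d+k)
    (interval-∩ (edge-interval k S) B-interval)

  only-A-interval : IsInterval (A ─ B) s (s + d)
  only-A-interval = interval-cong refl (m≥n⇒m⊓n≡n s+d≤s+k)
    (interval-─-upper s+k≤s+d+k (edge-interval k S) B-interval)

  only-B-interval : IsInterval (B ─ A) (s + k) (s + d + k)
  only-B-interval = interval-cong (m≤n⇒m⊔n≡n s+d≤s+k) refl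
    (interval-─-lower (m≤m+n s d) B-interval (edge-interval k S))

  common-size : ∣ A ∩ B ∣ ≡ k ∸ d
  common-size = trans (interval-size _ _ _ (+-monoˡ-≤ k (start≤k S)) common-interval) ([m+n]∸[m+o]≡n∸o s k d)

  meets : (V : Fin (suc k)) {p : Subset (k + k)} {lo hi lo′ hi′ : ℕ} → IsInterval p lo hi →
    (toℕ V + k) ⊓ hi ≡ hi′ → toℕ V ⊔ lo ≡ lo′ → ∣ tightEdge k V ∩ p ∣ ≡ hi′ ∸ lo′
  meets V p-int hi-eq lo-eq = trans (edge-meets-interval k V p-int) (cong₂ _∸_ hi-eq lo-eq)

  middle-profile : (V : Fin (suc k)) → s ≤ toℕ V → toℕ V ≤ s + d →
    ∣ tightEdge k V ∩ (A ∩ B) ∣ ≡ ∣ A ∩ B ∣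
    × ∣ tightEdge k V ∩ (A ─ B) ∣ ≡ (s + d) ∸ toℕ V
    × ∣ tightEdge k V ∩ (B ─ A) ∣ ≡ toℕ V ∸ s
  middle-profile V s≤v v≤s+d =
    trans (meets V common-interval (m≥n⇒m⊓n≡n (+-monoˡ-≤ k s≤v)) (m≤n⇒m⊔n≡n v≤s+d))
          (trans ([m+n]∸[m+o]≡n∸o s k d) (sym common-size))
    , meets V only-A-interval (m≥n⇒m⊓n≡n (≤-trans s+d≤k (m≤n+m k (toℕ V)))) (m≥n⇒m⊔n≡m s≤v)
    , trans (meets V only-B-interval (m≤n⇒m⊓n≡m (+-monoˡ-≤ k v≤s+d))
                                     (m≤n⇒m⊔n≡n (≤-trans (start≤k V) (m≤n+m k s))))
            ([m+o]∸[n+o]≡m∸n (toℕ V) s k)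

  left-profile : (V : Fin (suc k)) → toℕ V < s →
    suc ∣ tightEdge k V ∩ (A ∩ B) ∣ ≤ ∣ A ∩ B ∣
    × ∣ tightEdge k V ∩ (B ─ A) ∣ ≡ 0
    × ∣ tightEdge k V ∩ (A ─ B) ∣ ≡ d
  left-profile V v<s = common-lt , only-B-empty , only-A-full
    where
    v : ℕ
    v = toℕ V
    v≤s : v ≤ s
    v≤s = <⇒≤ v<s
    common-lt : ∣ tightEdge k V ∩ (A ∩ B) ∣ < ∣ A ∩ B ∣
    common-lt = begin-strict
      ∣ tightEdge k V ∩ (A ∩ B) ∣  ≡⟨ meets V common-interval (m≤n⇒m⊓n≡m (+-monoˡ-≤ k v≤s))
                                                              (m≤n⇒m⊔n≡n (≤-trans v≤s (m≤m+n s d))) ⟩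
      (v + k) ∸ (s + d)            <⟨ ∸-monoˡ-< (+-monoˡ-< k v<s) (≤-trans s+d≤k (m≤n+m k v)) ⟩
      (s + k) ∸ (s + d)            ≡⟨ [m+n]∸[m+o]≡n∸o s k d ⟩
      k ∸ d                        ≡⟨ sym common-size ⟩
      ∣ A ∩ B ∣                    ∎
      where open ≤-Reasoning
    only-B-empty : ∣ tightEdge k V ∩ (B ─ A) ∣ ≡ 0
    only-B-empty = trans (meets V only-B-interval (m≤n⇒m⊓n≡m (≤-trans (+-monoˡ-≤ k v≤s) s+k≤s+d+k))
                                                  (m≤n⇒m⊔n≡n (≤-trans v≤s (m≤m+n s k))))
                         (m≤n⇒m∸n≡0 (+-monoˡ-≤ k v≤s))
    only-A-full : ∣ tightEdge k V ∩ (A ─ B) ∣ ≡ d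
    only-A-full = trans (meets V only-A-interval (m≥n⇒m⊓n≡n (≤-trans s+d≤k (m≤n+m k v))) (m≤n⇒m⊔n≡n v≤s))
                        (m+n∸m≡n s d)

  right-profile : (V : Fin (suc k)) → s + d < toℕ V →
    suc ∣ tightEdge k V ∩ (A ∩ B) ∣ ≤ ∣ A ∩ B ∣
    × ∣ tightEdge k V ∩ (A ─ B) ∣ ≡ 0
    × ∣ tightEdge k V ∩ (B ─ A) ∣ ≡ d
  right-profile V s+d<v = common-lt , only-A-empty , only-B-full
    where
    v : ℕ
    v = toℕ V
    s≤v : s ≤ v
    s≤v = ≤-trans (m≤m+n s d) (<⇒≤ s+d<v)
    v≤s+k : v ≤ s + k
    v≤s+k = ≤-trans (start≤k V) (m≤n+m k s)
    common-lt : ∣ tightEdge k V ∩ (A ∩ B) ∣ < ∣ A ∩ B ∣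
    common-lt = begin-strict
      ∣ tightEdge k V ∩ (A ∩ B) ∣  ≡⟨ meets V common-interval (m≥n⇒m⊓n≡n (+-monoˡ-≤ k s≤v))
                                                              (m≥n⇒m⊔n≡m (<⇒≤ s+d<v)) ⟩
      (s + k) ∸ v                  <⟨ ∸-monoʳ-< s+d<v v≤s+k ⟩
      (s + k) ∸ (s + d)            ≡⟨ [m+n]∸[m+o]≡n∸o s k d ⟩
      k ∸ d                        ≡⟨ sym common-size ⟩
      ∣ A ∩ B ∣                    ∎
      where open ≤-Reasoning
    only-A-empty : ∣ tightEdge k V ∩ (A ─ B) ∣ ≡ 0
    only-A-empty = trans (meets V only-A-interval (m≥n⇒m⊓n≡n (≤-trans s+d≤k (m≤n+m k v))) (m≥n⇒m⊔n≡m s≤v))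
                         (m≤n⇒m∸n≡0 (<⇒≤ s+d<v))
    only-B-full : ∣ tightEdge k V ∩ (B ─ A) ∣ ≡ d
    only-B-full = trans (meets V only-B-interval (m≥n⇒m⊓n≡n (+-monoˡ-≤ k (<⇒≤ s+d<v))) (m≤n⇒m⊔n≡n v≤s+k))
                        (trans ([m+o]∸[n+o]≡m∸n (s + d) s k) (m+n∸m≡n s d))

  -- The edge e_{i+1} starts at s + offset i, strictly between a₀ and a₁; offset i + (i + 1) = d.
  offset : Fin (d ∸ 1) → ℕ
  offset i = suc (toℕ (opposite i))

  offset-complement : (i : Fin (d ∸ 1)) → offset i + suc (toℕ i) ≡ d
  offset-complement = opposite-complement d

  offset≤d : (i : Fin (d ∸ 1)) → offset i ≤ d
  offset≤d i = subst (offset i ≤_) (offset-complement i) (m≤m+n (offset i) (suc (toℕ i)))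

  intermediate-start : Fin (d ∸ 1) → Fin (suc k)
  intermediate-start i = fromℕ< (s≤s (≤-trans (+-monoʳ-≤ s (offset≤d i)) s+d≤k))

  intermediate-start-value : (i : Fin (d ∸ 1)) → toℕ (intermediate-start i) ≡ s + offset i
  intermediate-start-value i = toℕ-fromℕ< _

  intermediate : Fin (d ∸ 1) → Subset (k + k)
  intermediate i = tightEdge k (intermediate-start i)

  intermediate-injective : (i j : Fin (d ∸ 1)) → intermediate i ≡ intermediate j → i ≡ j
  intermediate-injective i j eq = opposite-injective i j (toℕ-injective (suc-injective
    (+-cancelˡ-≡ s _ _ (begin
      s + offset i                     ≡⟨ sym (intermediate-start-value i) ⟩
      toℕ (intermediate-start i)       ≡⟨ cong toℕ (edge-injective k k≥1 _ _ eq) ⟩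
      toℕ (intermediate-start j)       ≡⟨ intermediate-start-value j ⟩
      s + offset j                     ∎))))
    where open ≡-Reasoning

  intermediate-edge : (i : Fin (d ∸ 1)) → IsIntermediateEdge k A B (A ∩ B) ∣ A ∩ B ∣ d i (intermediate i)
  intermediate-edge i = (intermediate-start i , refl) , ≢A , ≢B , proj₁ profile , only-A , only-B
    where
    open ≡-Reasoning
    v : ℕ
    v = toℕ (intermediate-start i)
    v≡s+offset : v ≡ s + offset i
    v≡s+offset = intermediate-start-value i
    profile : ∣ intermediate i ∩ (A ∩ B) ∣ ≡ ∣ A ∩ B ∣
      × ∣ intermediate i ∩ (A ─ B) ∣ ≡ (s + d) ∸ v
      × ∣ intermediate i ∩ (B ─ A) ∣ ≡ v ∸ s
    profile = middle-profile (intermediate-start i)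
      (subst (s ≤_) (sym v≡s+offset) (m≤m+n s (offset i)))
      (subst (_≤ s + d) (sym v≡s+offset) (+-monoʳ-≤ s (offset≤d i)))
    only-A : ∣ intermediate i ∩ (A ─ B) ∣ ≡ suc (toℕ i)
    only-A = begin
      ∣ intermediate i ∩ (A ─ B) ∣  ≡⟨ proj₁ (proj₂ profile) ⟩
      (s + d) ∸ v                   ≡⟨ cong ((s + d) ∸_) v≡s+offset ⟩
      (s + d) ∸ (s + offset i)      ≡⟨ [m+n]∸[m+o]≡n∸o s d (offset i) ⟩
      d ∸ offset i                  ≡⟨ complement-left {a = offset i} (offset-complement i) ⟩
      suc (toℕ i)                   ∎
    only-B : ∣ intermediate i ∩ (B ─ A) ∣ ≡ d ∸ suc (toℕ i)
    only-B = begin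
      ∣ intermediate i ∩ (B ─ A) ∣  ≡⟨ proj₂ (proj₂ profile) ⟩
      v ∸ s                         ≡⟨ cong (_∸ s) v≡s+offset ⟩
      (s + offset i) ∸ s            ≡⟨ m+n∸m≡n s (offset i) ⟩
      offset i                      ≡⟨ sym (complement-right {b = suc (toℕ i)} (offset-complement i)) ⟩
      d ∸ suc (toℕ i)               ∎
    start-is : (U : Fin (suc k)) → intermediate i ≡ tightEdge k U → toℕ U ≡ s + offset i
    start-is U eq = trans (cong toℕ (sym (edge-injective k k≥1 _ _ eq))) v≡s+offset
    ≢A : intermediate i ≢ A
    ≢A eq = m+1+n≢m s (sym (start-is S eq))
    ≢B : intermediate i ≢ B
    ≢B eq = m+1+n≢m (offset i) (trans (offset-complement i) (sym offset≡d))
      where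
      offset≡d : offset i ≡ d
      offset≡d = +-cancelˡ-≡ s _ _ (trans (sym (start-is T eq)) T-start)

  intermediate-surjective : (V : Fin (suc k)) → s < toℕ V → toℕ V < s + d →
    Σ (Fin (d ∸ 1)) λ i → intermediate-start i ≡ V
  intermediate-surjective V s<v v<s+d = opposite j′ , toℕ-injective (begin
    toℕ (intermediate-start (opposite j′))   ≡⟨ intermediate-start-value (opposite j′) ⟩
    s + suc (toℕ (opposite (opposite j′)))   ≡⟨ cong (λ x → s + suc (toℕ x)) (opposite-involutive j′) ⟩
    s + suc (toℕ j′)                         ≡⟨ cong (λ x → s + suc x) (toℕ-fromℕ< j<d∸1) ⟩
    s + suc j                                ≡⟨ s+suc-j≡v ⟩
    toℕ V                                    ∎)
    where
    open ≡-Reasoning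
    j : ℕ
    j = toℕ V ∸ suc s
    s+suc-j≡v : s + suc j ≡ toℕ V
    s+suc-j≡v = trans (+-suc s j) (m+[n∸m]≡n s<v)
    j<d∸1 : j < d ∸ 1
    j<d∸1 = ∸-monoˡ-≤ 1 (+-cancelˡ-< s (suc j) d (subst (_< s + d) (sym s+suc-j≡v) v<s+d))
    j′ : Fin (d ∸ 1)
    j′ = fromℕ< j<d∸1

  -- Any other edge starts left of a₀ or right of a₁, so it is outer.
  outer : (e′ : Subset (k + k)) → IsEdge k e′ → e′ ≢ A → e′ ≢ B → ((i : Fin (d ∸ 1)) → e′ ≢ intermediate i) →
    IsOuterEdge k A B (A ∩ B) ∣ A ∩ B ∣ d e′
  outer _ (V , refl) ≢A ≢B ≢e with <-cmp (toℕ V) s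
  ... | tri< v<s _ _ = inj₂ (left-profile V v<s)
  ... | tri≈ _ v≡s _ = ⊥-elim (≢A (cong (tightEdge k) (toℕ-injective v≡s)))
  ... | tri> _ _ s<v with <-cmp (toℕ V) (s + d)
  ...   | tri< v<s+d _ _ = let (i , start≡V) = intermediate-surjective V s<v v<s+d in
                           ⊥-elim (≢e i (cong (tightEdge k) (sym start≡V)))
  ...   | tri≈ _ v≡s+d _ = ⊥-elim (≢B (cong (tightEdge k) (toℕ-injective (trans v≡s+d (sym T-start)))))
  ...   | tri> _ _ s+d<v = inj₁ (right-profile V s+d<v)

  conclusion : Conclusion k A B (A ∩ B) ∣ A ∩ B ∣ (k ∸ ∣ A ∩ B ∣)
  conclusion = subst (Conclusion k A B (A ∩ B) ∣ A ∩ B ∣) d≡k∸m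
    (intermediate , intermediate-injective , intermediate-edge , outer)
    where
    d≡k∸m : d ≡ k ∸ ∣ A ∩ B ∣
    d≡k∸m = sym (trans (cong (k ∸_) common-size) (m∸[m∸n]≡n (≤-trans (m≤n+m d s) s+d≤k)))

-- The conclusion holds for any two edges of T^k_{2k}, k ≥ 1: order them by their starts and
-- exchange them if necessary.  (For a₀ = a₁ there are no intermediate edges.)
edge-pair-conclusion : (k : ℕ) → 1 ≤ k → (S T : Fin (suc k)) →
  let a₀ = tightEdge k S; a₁ = tightEdge k T in Conclusion k a₀ a₁ (a₀ ∩ a₁) ∣ a₀ ∩ a₁ ∣ (k ∸ ∣ a₀ ∩ a₁ ∣)
edge-pair-conclusion k k≥1 S T with ≤-total (toℕ S) (toℕ T)
... | inj₁ S≤T = LeftToRight.conclusion k k≥1 S T (toℕ T ∸ toℕ S) (sym (m+[n∸m]≡n S≤T))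
... | inj₂ T≤S = subst (λ c → Conclusion k (tightEdge k S) (tightEdge k T) c ∣ c ∣ (k ∸ ∣ c ∣))
                       (∩-comm (tightEdge k T) (tightEdge k S))
                       (swap-conclusion (LeftToRight.conclusion k k≥1 T S (toℕ S ∸ toℕ T) (sym (m+[n∸m]≡n T≤S))))

-- Lemma 5.4.
lemma5p4 : (k : ℕ) → 3 ≤ k → (a₀ a₁ : Subset (k + k)) → IsEdge k a₀ → IsEdge k a₁ → a₀ ≢ a₁ →
    1 ≤ ∣ a₀ ∩ a₁ ∣ →
    Σ (Fin (k ∸ ∣ a₀ ∩ a₁ ∣ ∸ 1) → Subset (k + k)) λ e →
      ((i j : Fin (k ∸ ∣ a₀ ∩ a₁ ∣ ∸ 1)) → e i ≡ e j → i ≡ j)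
      × ((i : Fin (k ∸ ∣ a₀ ∩ a₁ ∣ ∸ 1)) →
          IsEdge k (e i) × e i ≢ a₀ × e i ≢ a₁
          × ∣ e i ∩ (a₀ ∩ a₁) ∣ ≡ ∣ a₀ ∩ a₁ ∣
          × ∣ e i ∩ (a₀ ─ a₁) ∣ ≡ suc (toℕ i)
          × ∣ e i ∩ (a₁ ─ a₀) ∣ ≡ k ∸ ∣ a₀ ∩ a₁ ∣ ∸ suc (toℕ i))
      × ((e′ : Subset (k + k)) → IsEdge k e′ → e′ ≢ a₀ → e′ ≢ a₁ →
          ((i : Fin (k ∸ ∣ a₀ ∩ a₁ ∣ ∸ 1)) → e′ ≢ e i) →
          (suc ∣ e′ ∩ (a₀ ∩ a₁) ∣ ≤ ∣ a₀ ∩ a₁ ∣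
            × ∣ e′ ∩ (a₀ ─ a₁) ∣ ≡ 0
            × ∣ e′ ∩ (a₁ ─ a₀) ∣ ≡ k ∸ ∣ a₀ ∩ a₁ ∣)
          ⊎ (suc ∣ e′ ∩ (a₀ ∩ a₁) ∣ ≤ ∣ a₀ ∩ a₁ ∣
            × ∣ e′ ∩ (a₁ ─ a₀) ∣ ≡ 0
            × ∣ e′ ∩ (a₀ ─ a₁) ∣ ≡ k ∸ ∣ a₀ ∩ a₁ ∣))
lemma5p4 k k≥3 _ _ (S , refl) (T , refl) _ _ = edge-pair-conclusion k (≤-trans (s≤s z≤n) k≥3) S T
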